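{- Suppose that $\varepsilon$ is $1$-symmetric and let $q$ be a prime with $q \notin \mathfrak P$. Then there is no $i \in S_n$ such that $\{i\} \in \mathcal D$ and $p_i \equiv 1 \pmod q$.
   Context: Standing setting: $n \ge 3$ is an integer, $S_n = \{1,\ldots,n\}$; for a set $X$, $\mathcal P_\star(X)$ is the family of finite nonempty proper subsets of $X$ and $\mathcal P_k(X)$ the family of $k$-element subsets. Let $p_1 < p_2 < \cdots < p_n$ be primes, $\mathfrak P = \{p_1,\ldots,p_n\}$, $v_1,\ldots,v_n$ positive integers, $\mathcal D$ a nonempty subfamily of $\mathcal P_\star(S_n)$, and $\varepsilon:\mathcal P_\star(S_n)\to\{\pm1\}$ a map, with $\varepsilon_I := \varepsilon(I)$ and $\varepsilon_{ -I} := \varepsilon(S_n\setminus I)$. Standing hypothesis: every prime $q$ dividing $\prod_{i\in I} p_i^{v_i} - \varepsilon_I$ for some $I \in \mathcal D$ belongs to $\mathfrak P$. Let $\mathcal D^{\mathrm{op}} := \{S_n\setminus I : I \in \mathcal D\}$. The map $\varepsilon$ is called $1$-symmetric if (i) every $I \in \mathcal D$ with $|I| = 1$ belongs to $\mathcal D^{\mathrm{op}}$, and (ii) $\varepsilon_I = \varepsilon_{ -I}$ for every $I \in \mathcal D$ with $|I| = 1$. -}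

module Defs where

open import Data.Nat using (ℕ; zero; suc; _*_; _^_)
open import Data.Nat.Primality using (Prime)
open import Data.Fin using (Fin; zero; suc)
open import Data.Fin.Subset using (Subset; ∁; ∣_∣; Nonempty; ⁅_⁆)
open import Data.Vec using ([]; _∷_)
open import Data.Bool using (true; false)
open import Data.Sign using (Sign)
open import Data.Integer using (ℤ; +_; _◃_; _-_)
open import Data.Integer.Divisibility using () renaming (_∣_ to _∣ℤ_)
open import Data.Product using (∃; _×_)
open import Relation.Binary.PropositionalEquality using (_≡_)
open import Function using (_∘_)

-- S_n is modelled as Fin n (index i : Fin n stands for i+1); subsets as Subset n.

prodSub : ∀ {n} → (Fin n → ℕ) → Subset n → ℕ
prodSub f [] = 1
prodSub f (true ∷ I) = f zero * prodSub (f ∘ suc) I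
prodSub f (false ∷ I) = prodSub (f ∘ suc) I

primeProd : ∀ {n} → (Fin n → ℕ) → (Fin n → ℕ) → Subset n → ℕ
primeProd p v I = prodSub (λ i → p i ^ v i) I

signℤ : Sign → ℤ
signℤ s = s ◃ 1

InP : ∀ {n} → (Fin n → ℕ) → ℕ → Set
InP p q = ∃ λ i → q ≡ p i

InPstar : ∀ {n} → Subset n → Set
InPstar I = Nonempty I × Nonempty (∁ I)

StandingHyp : ∀ {n} → (Fin n → ℕ) → (Fin n → ℕ) → (Subset n → Set) → (Subset n → Sign) → Set
StandingHyp {n} p v D ε =
  (I : Subset n) → D I → (q : ℕ) → Prime q →
  (+ q) ∣ℤ (+ primeProd p v I - signℤ (ε I)) → InP p q

-- ε is 1-symmetric (I ∈ D^op ⇔ S_n ∖ I ∈ D; ε_{-I} = ε(S_n ∖ I))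
OneSymmetric : ∀ {n} → (Subset n → Set) → (Subset n → Sign) → Set
OneSymmetric {n} D ε =
  ((I : Subset n) → D I → ∣ I ∣ ≡ 1 → D (∁ I)) ×
  ((I : Subset n) → D I → ∣ I ∣ ≡ 1 → ε I ≡ ε (∁ I))

module Submission where

-- Write ε_i for ε({i}) and suppose {i} ∈ D and q ∣ p_i - 1 with q ∉ 𝔓.
--   * If ε_i = +1, then p_i ≡ 1 (mod q) gives q ∣ p_i^{v_i} - ε_i, so the
--     standing hypothesis puts q in 𝔓.
--   * If ε_i = -1, 1-symmetry gives S_n∖{i} ∈ D with sign -1.  Put
--     B = ∏_{j≠i} p_j^{v_j}.  Every prime factor of B + 1 lies in 𝔓 by the
--     standing hypothesis, and cannot be a p_j with j ≠ i (it would divide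
--     both B and B + 1), so it is p_i ≡ 1 (mod q).  Hence B + 1 ≡ 1 (mod q),
--     i.e. q ∣ B, and a prime dividing B is one of the p_j: again q ∈ 𝔓.

open import Defs
open import Data.Nat using (ℕ; zero; suc; _+_; _*_; _^_; _≤_; _<_; _∸_; s≤s)
open import Data.Nat.Properties using (+-comm; *-identityʳ; m∸n+n≡m)
open import Data.Nat.Primality using (Prime; ¬prime[1]; euclidsLemma; prime⇒irreducible)
open import Data.Nat.Primality.Factorisation using (factorise; module PrimeFactorisation)
open import Data.Nat.Divisibility
  using (_∣_; ∣-trans; ∣1⇒≡1; ∣m∣n⇒∣m+n; ∣m+n∣m⇒∣n; m∣m*n; n∣m*n; ∣m⇒∣m*n; ∣n⇒∣m*n; _∣0)
open import Data.Nat.ListAction using (product)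
open import Data.List using (List; []; _∷_)
open import Data.List.Relation.Unary.All using (All; []; _∷_)
open import Data.Fin using (Fin; zero; suc) renaming (_<_ to _<ᶠ_)
open import Data.Fin.Properties using () renaming (_≟_ to _≟ᶠ_)
open import Data.Fin.Subset using (Subset; ⁅_⁆; ∁; _∈_; ⊥)
open import Data.Fin.Subset.Properties using (∣⁅x⁆∣≡1; x∈⁅y⁆⇒x≡y; x∉p⇒x∈∁p)
open import Data.Vec using ([]; _∷_; here; there)
open import Data.Bool using (true; false)
open import Data.Sign using (Sign)
open import Data.Integer using (+_; _-_)
open import Data.Integer.Divisibility using () renaming (_∣_ to _∣ℤ_)
open import Data.Product using (∃; _×_; _,_)
open import Data.Sum using (inj₁; inj₂)
open import Data.Empty using (⊥-elim)
open import Relation.Nullary using (¬_; yes; no)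
open import Relation.Binary.PropositionalEquality using (_≡_; refl; sym; trans; cong; subst)
open import Function using (_∘_)

data OneMod (q : ℕ) : ℕ → Set where
  1+ : ∀ {k} → q ∣ k → OneMod q (suc k)

-- A prime x with q ∣ x - 1 is 1 (mod q); primes are positive, so x - 1 is exact.
prime⇒OneMod : ∀ {q x} → Prime x → q ∣ x ∸ 1 → OneMod q x
prime⇒OneMod {x = suc x} _ q∣x = 1+ q∣x

-- (1 + a)(1 + b) = 1 + (b + a(1 + b)).
OneMod-* : ∀ {q a b} → OneMod q a → OneMod q b → OneMod q (a * b)
OneMod-* {b = suc b} (1+ q∣a) (1+ q∣b) = 1+ (∣m∣n⇒∣m+n q∣b (∣m⇒∣m*n (suc b) q∣a))

OneMod-1 : ∀ {q} → OneMod q 1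
OneMod-1 {q} = 1+ (q ∣0)

OneMod-^ : ∀ {q a} k → OneMod q a → OneMod q (a ^ k)
OneMod-^ zero    _ = OneMod-1
OneMod-^ (suc k) h = OneMod-* h (OneMod-^ k h)

OneMod-product : ∀ {q} (as : List ℕ) → All (OneMod q) as → OneMod q (product as)
OneMod-product []       []       = OneMod-1
OneMod-product (a ∷ as) (h ∷ hs) = OneMod-* h (OneMod-product as hs)

OneMod-byPrimeFactors : ∀ {q} m → (∀ {r} → Prime r → r ∣ suc m → OneMod q r) → OneMod q (suc m)
OneMod-byPrimeFactors {q} m factors-ok =
  subst (OneMod q) (sym isFactorisation) (OneMod-product factors (allOneMod factorsPrime (λ r∣ → r∣)))
  where
  open PrimeFactorisation (factorise (suc m))
  allOneMod : ∀ {as} → All Prime as → (∀ {d} → d ∣ product as → d ∣ product factors) → All (OneMod q) as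
  allOneMod []         _   = []
  allOneMod {a ∷ as} (pa ∷ ps) sub =
    factors-ok pa (subst (a ∣_) (sym isFactorisation) (sub (m∣m*n (product as))))
      ∷ allOneMod ps (λ d∣ → sub (∣-trans d∣ (n∣m*n a)))

prime∣^⇒∣ : ∀ {r} x k → Prime r → r ∣ x ^ k → r ∣ x
prime∣^⇒∣ x zero    r-prime r∣1 = ⊥-elim (¬prime[1] (subst Prime (∣1⇒≡1 r∣1) r-prime))
prime∣^⇒∣ x (suc k) r-prime r∣  with euclidsLemma x (x ^ k) r-prime r∣
... | inj₁ r∣x  = r∣x
... | inj₂ r∣xᵏ = prime∣^⇒∣ x k r-prime r∣xᵏ

prime∣prodSub : ∀ {n r} (f : Fin n → ℕ) (I : Subset n) → Prime r → r ∣ prodSub f I → ∃ λ j → r ∣ f j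
prime∣prodSub f []          r-prime r∣1 = ⊥-elim (¬prime[1] (subst Prime (∣1⇒≡1 r∣1) r-prime))
prime∣prodSub f (true ∷ I)  r-prime r∣  with euclidsLemma (f zero) (prodSub (f ∘ suc) I) r-prime r∣
... | inj₁ r∣f0 = zero , r∣f0
... | inj₂ r∣ps with prime∣prodSub (f ∘ suc) I r-prime r∣ps
...   | j , r∣fj = suc j , r∣fj
prime∣prodSub f (false ∷ I) r-prime r∣ with prime∣prodSub (f ∘ suc) I r-prime r∣
... | j , r∣fj = suc j , r∣fj

∈⇒∣prodSub : ∀ {n} (f : Fin n → ℕ) (I : Subset n) {j} → j ∈ I → f j ∣ prodSub f I
∈⇒∣prodSub f (true ∷ I)  here      = m∣m*n (prodSub (f ∘ suc) I)
∈⇒∣prodSub f (true ∷ I)  (there j∈) = ∣n⇒∣m*n (f zero) (∈⇒∣prodSub (f ∘ suc) I j∈)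
∈⇒∣prodSub f (false ∷ I) (there j∈) = ∈⇒∣prodSub (f ∘ suc) I j∈

prodSub-⊥ : ∀ {n} (f : Fin n → ℕ) → prodSub f ⊥ ≡ 1
prodSub-⊥ {zero}  f = refl
prodSub-⊥ {suc n} f = prodSub-⊥ (f ∘ suc)

prodSub-⁅⁆ : ∀ {n} (f : Fin n → ℕ) (i : Fin n) → prodSub f ⁅ i ⁆ ≡ f i
prodSub-⁅⁆ {suc n} f zero    = trans (cong (f zero *_) (prodSub-⊥ (f ∘ suc))) (*-identityʳ (f zero))
prodSub-⁅⁆ {suc n} f (suc i) = prodSub-⁅⁆ (f ∘ suc) i

prime∣primeProd⇒InP : ∀ {n r} {p : Fin n → ℕ} (v : Fin n → ℕ) (I : Subset n) → (∀ i → Prime (p i)) →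
  Prime r → r ∣ primeProd p v I → InP p r
prime∣primeProd⇒InP {p = p} v I p-prime r-prime r∣ with prime∣prodSub (λ k → p k ^ v k) I r-prime r∣
... | j , r∣pʲ with prime⇒irreducible (p-prime j) (prime∣^⇒∣ (p j) (v j) r-prime r∣pʲ)
...   | inj₁ r≡1  = ⊥-elim (¬prime[1] (subst Prime r≡1 r-prime))
...   | inj₂ r≡pj = j , r≡pj

∈⇒∤suc-primeProd : ∀ {n} {p : Fin n → ℕ} (v : Fin n → ℕ) (I : Subset n) {j} → j ∈ I → 1 ≤ v j → Prime (p j) →
  ¬ (p j ∣ suc (primeProd p v I))
∈⇒∤suc-primeProd {p = p} v I {j} j∈I vj≥1 pj-prime pj∣ =
  ¬prime[1] (subst Prime (∣1⇒≡1 (∣m+n∣m⇒∣n pj∣B+1 pj∣B)) pj-prime)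
  where
  B : ℕ
  B = primeProd p v I
  pj∣pʲ : p j ∣ p j ^ v j
  pj∣pʲ = subst (λ k → p j ∣ p j ^ k) (trans (+-comm 1 (v j ∸ 1)) (m∸n+n≡m vj≥1)) (m∣m*n (p j ^ (v j ∸ 1)))
  pj∣B : p j ∣ B
  pj∣B = ∣-trans pj∣pʲ (∈⇒∣prodSub (λ k → p k ^ v k) I j∈I)
  pj∣B+1 : p j ∣ B + 1
  pj∣B+1 = subst (p j ∣_) (+-comm 1 B) pj∣

OneMod⇒∣ℤ : ∀ {q a} → OneMod q a → (+ q) ∣ℤ (+ a - signℤ Sign.+)
OneMod⇒∣ℤ (1+ q∣k) = q∣k

∣suc⇒∣ℤ : ∀ {r} a → r ∣ suc a → (+ r) ∣ℤ (+ a - signℤ Sign.-)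
∣suc⇒∣ℤ {r} a r∣ = subst (r ∣_) (+-comm 1 a) r∣

module Standing {n} (p v : Fin n → ℕ) (D : Subset n → Set) (ε : Subset n → Sign)
                (standing : StandingHyp p v D ε) {I : Subset n} (I∈D : D I) where

  standing₊ : ε I ≡ Sign.+ → ∀ {q} → Prime q → OneMod q (primeProd p v I) → InP p q
  standing₊ εI≡+ {q} q-prime ≡1 =
    standing I I∈D q q-prime (subst (λ s → (+ q) ∣ℤ (+ primeProd p v I - signℤ s)) (sym εI≡+) (OneMod⇒∣ℤ ≡1))

  standing₋ : ε I ≡ Sign.- → ∀ {r} → Prime r → r ∣ suc (primeProd p v I) → InP p r
  standing₋ εI≡- {r} r-prime r∣ =
    standing I I∈D r r-prime (subst (λ s → (+ r) ∣ℤ (+ primeProd p v I - signℤ s)) (sym εI≡-) (∣suc⇒∣ℤ _ r∣))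

lemma3 : (n : ℕ) → 3 ≤ n →
    (p : Fin n → ℕ) → (∀ i → Prime (p i)) → (∀ i j → i <ᶠ j → p i < p j) →
    (v : Fin n → ℕ) → (∀ i → 1 ≤ v i) →
    (D : Subset n → Set) → (∃ λ I → D I) → (∀ I → D I → InPstar I) →
    (ε : Subset n → Sign) →
    StandingHyp p v D ε →
    OneSymmetric D ε →
    (q : ℕ) → Prime q → ¬ InP p q →
    ¬ (∃ λ i → D ⁅ i ⁆ × q ∣ (p i ∸ 1))
lemma3 n _ p p-prime _ v v≥1 D _ _ ε standing (symD , symε) q q-prime q∉𝔓 (i , i∈D , q∣pi-1)
  with ε ⁅ i ⁆ in εi
... | Sign.+ = q∉𝔓 (Standing.standing₊ p v D ε standing i∈D εi q-prime
                     (subst (OneMod q) (sym (prodSub-⁅⁆ (λ k → p k ^ v k) i)) (OneMod-^ (v i) pi≡1)))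
  where
  pi≡1 : OneMod q (p i)
  pi≡1 = prime⇒OneMod (p-prime i) q∣pi-1
... | Sign.- = q∉𝔓 (prime∣primeProd⇒InP v (∁ ⁅ i ⁆) p-prime q-prime (q∣B (OneMod-byPrimeFactors B factor≡1)))
  where
  ∁i∈D : D (∁ ⁅ i ⁆)
  ∁i∈D = symD ⁅ i ⁆ i∈D (∣⁅x⁆∣≡1 i)
  ε∁i : ε (∁ ⁅ i ⁆) ≡ Sign.-
  ε∁i = trans (sym (symε ⁅ i ⁆ i∈D (∣⁅x⁆∣≡1 i))) εi
  B : ℕ
  B = primeProd p v (∁ ⁅ i ⁆)
  -- the only prime factor of B + 1 is p_i, which is 1 (mod q)
  factor≡1 : ∀ {r} → Prime r → r ∣ suc B → OneMod q r
  factor≡1 r-prime r∣ with Standing.standing₋ p v D ε standing ∁i∈D ε∁i r-prime r∣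
  ... | j , refl with j ≟ᶠ i
  ...   | yes refl = prime⇒OneMod (p-prime i) q∣pi-1
  ...   | no  j≢i  = ⊥-elim (∈⇒∤suc-primeProd v (∁ ⁅ i ⁆) (x∉p⇒x∈∁p (j≢i ∘ x∈⁅y⁆⇒x≡y i)) (v≥1 j) (p-prime j) r∣)
  q∣B : OneMod q (suc B) → q ∣ B
  q∣B (1+ q∣B) = q∣B
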